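{- For integers $1\le m\le n-1$, \[\sum_{k=m}^{n}\frac{1}{k(n-k+1)}\binom{2k}{k-m}\binom{2(n-k)}{n-k}=\frac{2m+1}{m(n+m+1)}\binom{2n}{n-m}.\] -}

module Defs where

open import Data.Nat using (ℕ; zero; suc; _+_; _*_; _∸_)
open import Data.Integer using (+_)
open import Data.Rational using (ℚ; _/_) renaming (_+_ to _+ℚ_; 0ℚ to 0ℚ)

-- frac a d = a / d as a rational number.  Convention: frac a 0 = 0
-- (this case never arises in the statement, where all denominators
-- are positive for the indicated ranges).
frac : ℕ → ℕ → ℚ
frac a zero    = 0ℚ
frac a (suc d) = (+ a) / suc d

sumFrom : ℕ → ℕ → (ℕ → ℚ) → ℚ
sumFrom a zero    f = 0ℚ
sumFrom a (suc c) f = f a +ℚ sumFrom (suc a) c f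

-- Σ_{k=m}^{n} f k   (empty if n < m)
sumRange : ℕ → ℕ → (ℕ → ℚ) → ℚ
sumRange m n f = sumFrom m (suc n ∸ m) f

{-# OPTIONS --safe #-}
-- Let c = 1 + x c² be the generating function of the Catalan numbers and let
-- ballot r j be the coefficient of x^j in c^r, so that the Cauchy product of
-- ballot a and ballot b is ballot (a + b).  By induction,
-- ballot (s+1) j = C(2j+s, j) − C(2j+s, j−1), which gives the closed forms
-- ballot r j = r/(r+j) · C(2j+r−1, j) = r/(r+2j) · C(2j+r, j).  With k = m + i the
-- k-th summand is ballot (2m) i · ballot 1 (n−k) / m, so the sum is
-- ballot (2m+1) (n−m) / m, whose closed form is the right-hand side.
module Submission where

open import Defs
open import Data.Nat using (ℕ; zero; suc; _+_; _*_; _∸_; _≤_; _<_; z≤n; s≤s; z<s)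
open import Data.Nat.Properties
open import Data.Nat.Combinatorics using (_C_; nCk≡nC[n∸k]; nCn≡1; nCk+nC[k+1]≡[n+1]C[k+1])
open import Data.Nat.Combinatorics.Specification using (k>n⇒nCk≡0)
open import Data.Nat.Tactic.RingSolver using (solve)
open import Data.List using ([]; _∷_)
open import Data.Product using (_,_)
open import Data.Rational using (ℚ)
open import Function using (_∘_)
open import Relation.Binary.PropositionalEquality
  using (_≡_; _≗_; refl; sym; trans; cong; cong₂; subst; subst₂; module ≡-Reasoning)
import Algebra.Properties.CommutativeSemigroup as CommSemigroupProperties
import Data.Integer as ℤ
import Data.Integer.Properties as ℤ
import Data.Rational as ℚ
import Data.Rational.Properties as ℚ
import Data.Rational.Unnormalised as ℚᵘ
import Data.Rational.Unnormalised.Properties as ℚᵘ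

open ≡-Reasoning
open CommSemigroupProperties +-commutativeSemigroup using ()
  renaming (x∙yz≈y∙xz to x+[y+z]≡y+[x+z]; interchange to [w+x]+[y+z]≡[w+y]+[x+z])
open CommSemigroupProperties *-commutativeSemigroup using ()
  renaming ( x∙yz≈y∙xz to x*[y*z]≡y*[x*z]; xy∙z≈zx∙y to [x*y]*z≡[z*x]*y
           ; xy∙z≈y∙zx to [x*y]*z≡y*[z*x]; interchange to [w*x]*[y*z]≡[w*y]*[x*z])

infixl 6.5 _C₋_

_C₋_ : ℕ → ℕ → ℕ
n C₋ zero  = 0
n C₋ suc k = n C k

nC0≡1 : ∀ n → n C 0 ≡ 1
nC0≡1 n = trans (nCk≡nC[n∸k] {k = 0} {n = n} z≤n) (nCn≡1 n)

[n+1]Ck≡nCk+nC₋k : ∀ n k → suc n C k ≡ n C k + n C₋ k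
[n+1]Ck≡nCk+nC₋k n zero    = trans (nC0≡1 (suc n)) (cong (_+ 0) (sym (nC0≡1 n)))
[n+1]Ck≡nCk+nC₋k n (suc k) = trans (sym (nCk+nC[k+1]≡[n+1]C[k+1] n k)) (+-comm (n C k) _)

mutual
  [k+1]*[n+1]C[k+1]≡[n+1]*nCk : ∀ n k → suc k * (suc n C suc k) ≡ suc n * (n C k)
  [k+1]*[n+1]C[k+1]≡[n+1]*nCk zero    zero    = refl
  [k+1]*[n+1]C[k+1]≡[n+1]*nCk zero    (suc k) = begin
    suc (suc k) * (1 C suc (suc k)) ≡⟨ cong (suc (suc k) *_) (k>n⇒nCk≡0 {1} {suc (suc k)} (s≤s z<s)) ⟩
    suc (suc k) * 0                 ≡⟨ *-zeroʳ (suc (suc k)) ⟩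
    0                               ≡⟨ cong (1 *_) (k>n⇒nCk≡0 {0} {suc k} z<s) ⟨
    1 * (0 C suc k)                 ∎
  [k+1]*[n+1]C[k+1]≡[n+1]*nCk (suc n) k = begin
    suc k * (suc (suc n) C suc k)            ≡⟨ cong (suc k *_) ([n+1]Ck≡nCk+nC₋k (suc n) (suc k)) ⟩
    suc k * (suc n C suc k + x)              ≡⟨ *-distribˡ-+ (suc k) (suc n C suc k) x ⟩
    suc k * (suc n C suc k) + (x + k * x)    ≡⟨ cong₂ (λ a b → a + (x + b))
                                                  ([k+1]*[n+1]C[k+1]≡[n+1]*nCk n k) (k*[n+1]Ck≡[n+1]*nC₋k n k) ⟩
    suc n * (n C k) + (x + suc n * (n C₋ k)) ≡⟨ x+[y+z]≡y+[x+z] (suc n * (n C k)) x _ ⟩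
    x + (suc n * (n C k) + suc n * (n C₋ k)) ≡⟨ cong (x +_) (*-distribˡ-+ (suc n) (n C k) (n C₋ k)) ⟨
    x + suc n * (n C k + n C₋ k)             ≡⟨ cong (λ y → x + suc n * y) ([n+1]Ck≡nCk+nC₋k n k) ⟨
    suc (suc n) * x                          ∎
    where x = suc n C k

  k*[n+1]Ck≡[n+1]*nC₋k : ∀ n k → k * (suc n C k) ≡ suc n * (n C₋ k)
  k*[n+1]Ck≡[n+1]*nC₋k n zero    = sym (*-zeroʳ n)
  k*[n+1]Ck≡[n+1]*nC₋k n (suc k) = [k+1]*[n+1]C[k+1]≡[n+1]*nCk n k

k*[k+u]Ck≡[u+1]*[k+u]C₋k : ∀ k u → k * ((k + u) C k) ≡ suc u * ((k + u) C₋ k)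
k*[k+u]Ck≡[u+1]*[k+u]C₋k zero    u = sym (*-zeroʳ (suc u))
k*[k+u]Ck≡[u+1]*[k+u]C₋k (suc k) u = +-cancelˡ-≡ (suc k * x) _ _ (begin
    suc k * x + suc k * (suc N C suc k) ≡⟨ *-distribˡ-+ (suc k) x _ ⟨
    suc k * (x + suc N C suc k)         ≡⟨ cong (suc k *_) (nCk+nC[k+1]≡[n+1]C[k+1] (suc N) k) ⟩
    suc k * (suc (suc N) C suc k)       ≡⟨ [k+1]*[n+1]C[k+1]≡[n+1]*nCk (suc N) k ⟩
    suc (suc N) * x                     ≡⟨ cong (λ y → suc y * x) (+-suc k u) ⟨
    (suc k + suc u) * x                 ≡⟨ *-distribʳ-+ x (suc k) (suc u) ⟩
    suc k * x + suc u * x               ∎)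
  where
    N = k + u
    x = suc N C k

[u+1]*[k+u+1]Ck≡[k+u+1]*[k+u]Ck : ∀ k u → suc u * (suc (k + u) C k) ≡ suc (k + u) * ((k + u) C k)
[u+1]*[k+u+1]Ck≡[k+u+1]*[k+u]Ck k u = begin
    suc u * (suc N C k)               ≡⟨ cong (suc u *_) ([n+1]Ck≡nCk+nC₋k N k) ⟩
    suc u * (N C k + N C₋ k)          ≡⟨ *-distribˡ-+ (suc u) (N C k) (N C₋ k) ⟩
    suc u * (N C k) + suc u * (N C₋ k) ≡⟨ cong (suc u * (N C k) +_) (k*[k+u]Ck≡[u+1]*[k+u]C₋k k u) ⟨
    suc u * (N C k) + k * (N C k)     ≡⟨ *-distribʳ-+ (N C k) (suc u) k ⟨
    (suc u + k) * (N C k)             ≡⟨ cong (λ y → suc y * (N C k)) (+-comm u k) ⟩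
    suc N * (N C k)                   ∎
  where N = k + u

[k+l]Ck≡[k+l]Cl : ∀ k l → (k + l) C k ≡ (k + l) C l
[k+l]Ck≡[k+l]Cl k l = trans (nCk≡nC[n∸k] (m≤m+n k l)) (cong ((k + l) C_) (m+n∸m≡n k l))

infixl 7 _⋆_

_⋆_ : (ℕ → ℕ) → (ℕ → ℕ) → ℕ → ℕ
(f ⋆ g) zero    = f 0 * g 0
(f ⋆ g) (suc j) = f 0 * g (suc j) + (f ∘ suc ⋆ g) j

⋆-congˡ : ∀ {f f′} g → f ≗ f′ → f ⋆ g ≗ f′ ⋆ g
⋆-congˡ g f≗f′ zero    = cong (_* g 0) (f≗f′ 0)
⋆-congˡ g f≗f′ (suc j) = cong₂ _+_ (cong (_* g (suc j)) (f≗f′ 0)) (⋆-congˡ g (f≗f′ ∘ suc) j)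

⋆-zeroˡ : ∀ g → (λ _ → 0) ⋆ g ≗ λ _ → 0
⋆-zeroˡ g zero    = refl
⋆-zeroˡ g (suc j) = ⋆-zeroˡ g j

⋆-distribʳ-+ : ∀ f h g j → ((λ i → f i + h i) ⋆ g) j ≡ (f ⋆ g) j + (h ⋆ g) j
⋆-distribʳ-+ f h g zero    = *-distribʳ-+ (g 0) (f 0) (h 0)
⋆-distribʳ-+ f h g (suc j) = begin
    (f 0 + h 0) * g (suc j) + ((λ i → f (suc i) + h (suc i)) ⋆ g) j
      ≡⟨ cong₂ _+_ (*-distribʳ-+ (g (suc j)) (f 0) (h 0)) (⋆-distribʳ-+ (f ∘ suc) (h ∘ suc) g j) ⟩
    (f 0 * g (suc j) + h 0 * g (suc j)) + ((f ∘ suc ⋆ g) j + (h ∘ suc ⋆ g) j)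
      ≡⟨ [w+x]+[y+z]≡[w+y]+[x+z] (f 0 * g (suc j)) _ _ _ ⟩
    (f ⋆ g) (suc j) + (h ⋆ g) (suc j)
      ∎

shift : (ℕ → ℕ) → ℕ → ℕ
shift f zero    = 0
shift f (suc i) = f i

-- The last clause is c^(r+1) = c^r + x c^(r+2).
ballot : ℕ → ℕ → ℕ
ballot zero    zero    = 1
ballot zero    (suc j) = 0
ballot (suc r) zero    = 1
ballot (suc r) (suc j) = ballot r (suc j) + ballot (suc (suc r)) j

ballot-zero : ∀ r → ballot r 0 ≡ 1
ballot-zero zero    = refl
ballot-zero (suc r) = refl

ballot-split : ∀ r → ballot (suc r) ≗ λ i → ballot r i + shift (ballot (suc (suc r))) i
ballot-split r zero    = sym (trans (+-identityʳ (ballot r 0)) (ballot-zero r))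
ballot-split r (suc i) = refl

ballot-⋆ : ∀ a b → ballot a ⋆ ballot b ≗ ballot (a + b)
ballot-⋆ a       b zero    = trans (cong₂ _*_ (ballot-zero a) (ballot-zero b)) (sym (ballot-zero (a + b)))
ballot-⋆ zero    b (suc j) = trans (cong₂ _+_ (*-identityˡ (ballot b (suc j))) (⋆-zeroˡ (ballot b) j)) (+-identityʳ _)
ballot-⋆ (suc a) b (suc j) = begin
    (ballot (suc a) ⋆ ballot b) (suc j)
      ≡⟨ ⋆-congˡ (ballot b) (ballot-split a) (suc j) ⟩
    ((λ i → ballot a i + shift (ballot (suc (suc a))) i) ⋆ ballot b) (suc j)
      ≡⟨ ⋆-distribʳ-+ (ballot a) (shift (ballot (suc (suc a)))) (ballot b) (suc j) ⟩
    (ballot a ⋆ ballot b) (suc j) + (shift (ballot (suc (suc a))) ⋆ ballot b) (suc j)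
      ≡⟨ cong₂ _+_ (ballot-⋆ a b (suc j)) (ballot-⋆ (suc (suc a)) b j) ⟩
    ballot (suc a + b) (suc j)
      ∎

ballot-difference : ∀ s j → ballot (suc s) j + (2 * j + s) C₋ j ≡ (2 * j + s) C j
ballot-difference s       zero    = sym (nC0≡1 s)
ballot-difference zero    (suc j) = begin
    ballot 2 j + M C j             ≡⟨ cong (λ L → ballot 2 j + L C j) M≡1+N ⟩
    ballot 2 j + suc N C j         ≡⟨ cong (ballot 2 j +_) ([n+1]Ck≡nCk+nC₋k N j) ⟩
    ballot 2 j + (N C j + N C₋ j)  ≡⟨ x+[y+z]≡y+[x+z] (ballot 2 j) (N C j) (N C₋ j) ⟩
    N C j + (ballot 2 j + N C₋ j)  ≡⟨ cong (N C j +_) (ballot-difference 1 j) ⟩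
    N C j + N C j                  ≡⟨ cong (N C j +_) NC[j+1]≡NCj ⟨
    N C j + N C suc j              ≡⟨ nCk+nC[k+1]≡[n+1]C[k+1] N j ⟩
    suc N C suc j                  ≡⟨ cong (λ L → L C suc j) M≡1+N ⟨
    M C suc j                      ∎
  where
    M = 2 * suc j + 0
    N = 2 * j + 1
    M≡1+N : 2 * suc j + 0 ≡ suc (2 * j + 1)
    M≡1+N = solve (j ∷ [])
    [j+1]+j≡N : suc j + j ≡ 2 * j + 1
    [j+1]+j≡N = solve (j ∷ [])
    NC[j+1]≡NCj : N C suc j ≡ N C j
    NC[j+1]≡NCj = subst (λ L → L C suc j ≡ L C j) [j+1]+j≡N ([k+l]Ck≡[k+l]Cl (suc j) j)
ballot-difference (suc s) (suc j) = begin
    T₁ + T₂ + M C j               ≡⟨ cong (λ L → T₁ + T₂ + L C j) M≡1+N ⟩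
    T₁ + T₂ + suc N C j           ≡⟨ cong (T₁ + T₂ +_) ([n+1]Ck≡nCk+nC₋k N j) ⟩
    T₁ + T₂ + (N C j + N C₋ j)    ≡⟨ [w+x]+[y+z]≡[w+y]+[x+z] T₁ T₂ (N C j) (N C₋ j) ⟩
    (T₁ + N C j) + (T₂ + N C₋ j)  ≡⟨ cong₂ _+_ (subst (λ L → T₁ + L C j ≡ L C suc j) 2[j+1]+s≡N
                                                         (ballot-difference s (suc j)))
                                                  (ballot-difference (suc (suc s)) j) ⟩
    N C suc j + N C j             ≡⟨ +-comm (N C suc j) (N C j) ⟩
    N C j + N C suc j             ≡⟨ nCk+nC[k+1]≡[n+1]C[k+1] N j ⟩
    suc N C suc j                 ≡⟨ cong (λ L → L C suc j) M≡1+N ⟨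
    M C suc j                     ∎
  where
    T₁ = ballot (suc s) (suc j)
    T₂ = ballot (suc (suc (suc s))) j
    M = 2 * suc j + suc s
    N = 2 * j + suc (suc s)
    M≡1+N : 2 * suc j + suc s ≡ suc (2 * j + suc (suc s))
    M≡1+N = solve (j ∷ s ∷ [])
    2[j+1]+s≡N : 2 * suc j + s ≡ 2 * j + suc (suc s)
    2[j+1]+s≡N = solve (j ∷ s ∷ [])

ballot-suc-closed-form : ∀ s j → (suc s + j) * ballot (suc s) j ≡ suc s * ((2 * j + s) C j)
ballot-suc-closed-form s j = +-cancelʳ-≡ (j * (N C j)) _ _ (begin
    c * T + j * (N C j)            ≡⟨ cong (c * T +_) j*NCj≡c*NC₋j ⟩
    c * T + c * (N C₋ j)           ≡⟨ *-distribˡ-+ c T (N C₋ j) ⟨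
    c * (T + N C₋ j)               ≡⟨ cong (c *_) (ballot-difference s j) ⟩
    c * (N C j)                    ≡⟨ *-distribʳ-+ (N C j) (suc s) j ⟩
    suc s * (N C j) + j * (N C j)  ∎)
  where
    c = suc s + j
    T = ballot (suc s) j
    N = 2 * j + s
    j+[s+j]≡2j+s : j + (s + j) ≡ 2 * j + s
    j+[s+j]≡2j+s = solve (j ∷ s ∷ [])
    j*NCj≡c*NC₋j : j * (N C j) ≡ c * (N C₋ j)
    j*NCj≡c*NC₋j = subst (λ L → j * (L C j) ≡ c * (L C₋ j)) j+[s+j]≡2j+s (k*[k+u]Ck≡[u+1]*[k+u]C₋k j (s + j))

ballot-closed-form : ∀ r j → (r + 2 * j) * ballot r j ≡ r * ((r + 2 * j) C j)
ballot-closed-form zero    zero    = refl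
ballot-closed-form zero    (suc j) = *-zeroʳ (2 * suc j)
ballot-closed-form (suc s) j       = *-cancelˡ-≡ _ _ c (begin
    c * (d * T)            ≡⟨ x*[y*z]≡y*[x*z] c d T ⟩
    d * (c * T)            ≡⟨ cong (d *_) (ballot-suc-closed-form s j) ⟩
    d * (suc s * B)        ≡⟨ x*[y*z]≡y*[x*z] d (suc s) B ⟩
    suc s * (d * B)        ≡⟨ cong (suc s *_) c*dCj≡d*B ⟨
    suc s * (c * (d C j))  ≡⟨ x*[y*z]≡y*[x*z] (suc s) c (d C j) ⟩
    c * (suc s * (d C j))  ∎)
  where
    c = suc s + j
    d = suc s + 2 * j
    T = ballot (suc s) j
    B = (2 * j + s) C j
    1+j+[s+j]≡d : suc (j + (s + j)) ≡ suc s + 2 * j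
    1+j+[s+j]≡d = solve (j ∷ s ∷ [])
    j+[s+j]≡2j+s : j + (s + j) ≡ 2 * j + s
    j+[s+j]≡2j+s = solve (j ∷ s ∷ [])
    c*dCj≡d*B : c * (d C j) ≡ d * B
    c*dCj≡d*B = subst₂ (λ L K → c * (L C j) ≡ L * (K C j)) 1+j+[s+j]≡d j+[s+j]≡2j+s
                  ([u+1]*[k+u+1]Ck≡[k+u+1]*[k+u]Ck j (s + j))

catalan-closed-form : ∀ q → (2 * q) C q ≡ suc q * ballot 1 q
catalan-closed-form q = sym (begin
    suc q * ballot 1 q      ≡⟨ ballot-suc-closed-form 0 q ⟩
    1 * ((2 * q + 0) C q)   ≡⟨ *-identityˡ _ ⟩
    (2 * q + 0) C q         ≡⟨ cong (_C q) (+-identityʳ (2 * q)) ⟩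
    (2 * q) C q             ∎)

ballot-even-closed-form : ∀ m i → (m + i) * ballot (2 * m) i ≡ m * ((2 * (m + i)) C i)
ballot-even-closed-form m i = *-cancelˡ-≡ _ _ 2 (begin
    2 * ((m + i) * T)               ≡⟨ *-assoc 2 (m + i) T ⟨
    2 * (m + i) * T                 ≡⟨ cong (_* T) 2[m+i]≡2m+2i ⟩
    (2 * m + 2 * i) * T             ≡⟨ ballot-closed-form (2 * m) i ⟩
    2 * m * ((2 * m + 2 * i) C i)   ≡⟨ cong (λ L → 2 * m * (L C i)) 2[m+i]≡2m+2i ⟨
    2 * m * ((2 * (m + i)) C i)     ≡⟨ *-assoc 2 m _ ⟩
    2 * (m * ((2 * (m + i)) C i))   ∎)
  where
    T = ballot (2 * m) i
    2[m+i]≡2m+2i : 2 * (m + i) ≡ 2 * m + 2 * i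
    2[m+i]≡2m+2i = *-distribˡ-+ 2 m i

ballot-odd-closed-form : ∀ m p → (2 * m + 1 + p) * ballot (2 * m + 1) p ≡ (2 * m + 1) * ((2 * (m + p)) C p)
ballot-odd-closed-form m p =
  subst₂ (λ r L → (r + p) * ballot r p ≡ r * (L C p)) (+-comm 1 (2 * m)) 2p+2m≡2[m+p]
    (ballot-suc-closed-form (2 * m) p)
  where
    2p+2m≡2[m+p] : 2 * p + 2 * m ≡ 2 * (m + p)
    2p+2m≡2[m+p] = solve (p ∷ m ∷ [])

frac-cross : ∀ a b c d → 0 < b → 0 < d → a * d ≡ c * b → frac a b ≡ frac c d
frac-cross a (suc b) c (suc d) z<s z<s ad≡cb =
  ℚ.fromℚᵘ-cong {ℚᵘ.mkℚᵘ (ℤ.+ a) b} {ℚᵘ.mkℚᵘ (ℤ.+ c) d} (ℚᵘ.*≡* (begin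
    ℤ.+ a ℤ.* ℤ.+ suc d  ≡⟨ ℤ.pos-* a (suc d) ⟨
    ℤ.+ (a * suc d)      ≡⟨ cong ℤ.+_ ad≡cb ⟩
    ℤ.+ (c * suc b)      ≡⟨ ℤ.pos-* c (suc b) ⟩
    ℤ.+ c ℤ.* ℤ.+ suc b  ∎))

frac-+ : ∀ a b d → 0 < d → frac a d ℚ.+ frac b d ≡ frac (a + b) d
frac-+ a b (suc d) z<s = ℚ.toℚᵘ-injective
  (ℚᵘ.≃-trans (ℚ.toℚᵘ-homo-+ (frac a D) (frac b D))
  (ℚᵘ.≃-trans (ℚᵘ.+-cong (ℚ.toℚᵘ-fromℚᵘ (a /D)) (ℚ.toℚᵘ-fromℚᵘ (b /D)))
  (ℚᵘ.≃-trans (ℚᵘ.*≡* numerators)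
              (ℚᵘ.≃-sym (ℚ.toℚᵘ-fromℚᵘ ((a + b) /D))))))
  where
    D = suc d
    _/D : ℕ → ℚᵘ.ℚᵘ
    x /D = ℚᵘ.mkℚᵘ (ℤ.+ x) d
    numerators : (ℤ.+ a ℤ.* ℤ.+ D ℤ.+ ℤ.+ b ℤ.* ℤ.+ D) ℤ.* ℤ.+ D ≡ ℤ.+ (a + b) ℤ.* ℤ.+ (D * D)
    numerators = begin
      (ℤ.+ a ℤ.* ℤ.+ D ℤ.+ ℤ.+ b ℤ.* ℤ.+ D) ℤ.* ℤ.+ D  ≡⟨ cong (ℤ._* ℤ.+ D) (ℤ.*-distribʳ-+ (ℤ.+ D) (ℤ.+ a) (ℤ.+ b)) ⟨
      (ℤ.+ a ℤ.+ ℤ.+ b) ℤ.* ℤ.+ D ℤ.* ℤ.+ D            ≡⟨ ℤ.*-assoc (ℤ.+ a ℤ.+ ℤ.+ b) (ℤ.+ D) (ℤ.+ D) ⟩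
      (ℤ.+ a ℤ.+ ℤ.+ b) ℤ.* (ℤ.+ D ℤ.* ℤ.+ D)          ≡⟨ cong₂ ℤ._*_ (ℤ.pos-+ a b) (ℤ.pos-* D D) ⟨
      ℤ.+ (a + b) ℤ.* ℤ.+ (D * D)                      ∎

sumFrom-cong : ∀ a c {f g} → f ≗ g → sumFrom a c f ≡ sumFrom a c g
sumFrom-cong a zero    f≗g = refl
sumFrom-cong a (suc c) f≗g = cong₂ ℚ._+_ (f≗g a) (sumFrom-cong (suc a) c f≗g)

sumFrom-suc : ∀ a c f → sumFrom (suc a) c f ≡ sumFrom a c (f ∘ suc)
sumFrom-suc a zero    f = refl
sumFrom-suc a (suc c) f = cong (f (suc a) ℚ.+_) (sumFrom-suc (suc a) c f)

sumFrom-+ : ∀ a c f → sumFrom a c f ≡ sumFrom 0 c (λ i → f (a + i))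
sumFrom-+ zero    c f = refl
sumFrom-+ (suc a) c f = trans (sumFrom-suc a c f) (sumFrom-+ a c (f ∘ suc))

sumRange-+ : ∀ m p f → sumRange m (m + p) f ≡ sumFrom 0 (suc p) (λ i → f (m + i))
sumRange-+ m p f = trans (cong (λ c → sumFrom m c f) [m+p+1]∸m≡p+1) (sumFrom-+ m (suc p) f)
  where
    [m+p+1]∸m≡p+1 : suc (m + p) ∸ m ≡ suc p
    [m+p+1]∸m≡p+1 = trans (cong (_∸ m) (sym (+-suc m p))) (m+n∸m≡n m (suc p))

sumFrom-frac-⋆ : ∀ f g j d → 0 < d →
  sumFrom 0 (suc j) (λ i → frac (f i * g (j ∸ i)) d) ≡ frac ((f ⋆ g) j) d
sumFrom-frac-⋆ f g zero    d@(suc _) _  = ℚ.+-identityʳ (frac (f 0 * g 0) d)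
sumFrom-frac-⋆ f g (suc j) d         0<d = begin
    frac (f 0 * g (suc j)) d ℚ.+ sumFrom 1 (suc j) F
      ≡⟨ cong (frac (f 0 * g (suc j)) d ℚ.+_)
              (trans (sumFrom-suc 0 (suc j) F) (sumFrom-frac-⋆ (f ∘ suc) g j d 0<d)) ⟩
    frac (f 0 * g (suc j)) d ℚ.+ frac ((f ∘ suc ⋆ g) j) d
      ≡⟨ frac-+ _ _ d 0<d ⟩
    frac ((f ⋆ g) (suc j)) d
      ∎
  where
    F : ℕ → ℚ
    F i = frac (f i * g (suc j ∸ i)) d

summand-as-ballot : ∀ m i q → 1 ≤ m →
  frac (((2 * (m + i)) C i) * ((2 * q) C q)) ((m + i) * suc q) ≡ frac (ballot (2 * m) i * ballot 1 q) m
summand-as-ballot m@(suc _) i q _ = frac-cross (A * B) ((m + i) * suc q) (T * U) m z<s z<s (begin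
    A * B * m                  ≡⟨ [x*y]*z≡[z*x]*y A B m ⟩
    m * A * B                  ≡⟨ cong₂ _*_ (sym (ballot-even-closed-form m i)) (catalan-closed-form q) ⟩
    (m + i) * T * (suc q * U)  ≡⟨ [w*x]*[y*z]≡[w*y]*[x*z] (m + i) T (suc q) U ⟩
    (m + i) * suc q * (T * U)  ≡⟨ *-comm ((m + i) * suc q) (T * U) ⟩
    T * U * ((m + i) * suc q)  ∎)
  where
    A = (2 * (m + i)) C i
    B = (2 * q) C q
    T = ballot (2 * m) i
    U = ballot 1 q

rhs-as-ballot : ∀ m p → 1 ≤ m →
  frac ((2 * m + 1) * ((2 * (m + p)) C p)) (m * (m + p + m + 1)) ≡ frac (ballot (2 * m + 1) p) m
rhs-as-ballot m p 1≤m = frac-cross ((2 * m + 1) * B) (m * (m + p + m + 1)) T m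
                       (*-mono-≤ 1≤m (m≤n+m 1 (m + p + m))) 1≤m (begin
    (2 * m + 1) * B * m          ≡⟨ cong (_* m) (ballot-odd-closed-form m p) ⟨
    (2 * m + 1 + p) * T * m      ≡⟨ cong (λ x → x * T * m) 2m+1+p≡m+p+m+1 ⟩
    (m + p + m + 1) * T * m      ≡⟨ [x*y]*z≡y*[z*x] (m + p + m + 1) T m ⟩
    T * (m * (m + p + m + 1))    ∎)
  where
    B = (2 * (m + p)) C p
    T = ballot (2 * m + 1) p
    2m+1+p≡m+p+m+1 : 2 * m + 1 + p ≡ m + p + m + 1
    2m+1+p≡m+p+m+1 = solve (m ∷ p ∷ [])

corollary4p2 : (m n : ℕ) → 1 ≤ m → m ≤ n ∸ 1 →
    sumRange m n (λ k → frac (((2 * k) C (k ∸ m)) * ((2 * (n ∸ k)) C (n ∸ k))) (k * (n ∸ k + 1)))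
      ≡ frac ((2 * m + 1) * ((2 * n) C (n ∸ m))) (m * (n + m + 1))
corollary4p2 m n 1≤m m≤n∸1 with m≤n⇒∃[o]m+o≡n (≤-trans m≤n∸1 (m∸n≤m n 1))
... | p , refl = begin
    sumRange m (m + p) F
      ≡⟨ sumRange-+ m p F ⟩
    sumFrom 0 (suc p) (λ i → F (m + i))
      ≡⟨ sumFrom-cong 0 (suc p) shifted-summand ⟩
    sumFrom 0 (suc p) (λ i → frac (ballot (2 * m) i * ballot 1 (p ∸ i)) m)
      ≡⟨ sumFrom-frac-⋆ (ballot (2 * m)) (ballot 1) p m 1≤m ⟩
    frac ((ballot (2 * m) ⋆ ballot 1) p) m
      ≡⟨ cong (λ x → frac x m) (ballot-⋆ (2 * m) 1 p) ⟩
    frac (ballot (2 * m + 1) p) m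
      ≡⟨ rhs-as-ballot m p 1≤m ⟨
    frac ((2 * m + 1) * ((2 * (m + p)) C p)) (m * (m + p + m + 1))
      ≡⟨ cong (λ x → frac ((2 * m + 1) * ((2 * (m + p)) C x)) (m * (m + p + m + 1))) (m+n∸m≡n m p) ⟨
    frac ((2 * m + 1) * ((2 * (m + p)) C (m + p ∸ m))) (m * (m + p + m + 1))
      ∎
  where
    F : ℕ → ℚ
    F k = frac (((2 * k) C (k ∸ m)) * ((2 * (m + p ∸ k)) C (m + p ∸ k))) (k * (m + p ∸ k + 1))
    shifted-summand : ∀ i → F (m + i) ≡ frac (ballot (2 * m) i * ballot 1 (p ∸ i)) m
    shifted-summand i rewrite m+n∸m≡n m i | [m+n]∸[m+o]≡n∸o m p i | +-comm (p ∸ i) 1 =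
      summand-as-ballot m i (p ∸ i) 1≤m
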